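{- Let $p=3$ and $n\ge1$. For $x=(x_0,\dots,x_{n-1})\in\mathbb{F}_3{}^n$, a minimal polynomial expression of $\max(x)$ is \[ \max(x)=\Bigl(\sum_{i=0}^{\lfloor n/2\rfloor}e_{2i}(x)\Bigr)\Bigl(\sum_{i=0}^{n}e_i(x)\Bigr)-1 . \]
   Context: $\mathbb{F}_3$ is identified with $\{0,1,2\}\subset\mathbb{Z}$ with the usual ordering, and $\max(x)$ is the largest among $x_0,\dots,x_{n-1}$ in this ordering. A minimal polynomial expression of a function $\mathbb{F}_p{}^n\to\mathbb{F}_p$ is a polynomial over $\mathbb{F}_p$ of degree at most $p-1$ in each variable which coincides with the function on all of $\mathbb{F}_p{}^n$. $e_i(x)$ is the $i$-th elementary symmetric polynomial in $x_0,\dots,x_{n-1}$ ($e_0=1$), so $\prod_{i=0}^{n-1}(1+x_i)=\sum_{i=0}^n e_i(x)$. -}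

module Defs where

open import Data.Nat using (ℕ; zero; suc; _≤ᵇ_) renaming (_+_ to _+ℕ_; _*_ to _*ℕ_)
open import Data.Nat.DivMod using (_mod_)
open import Data.Fin using (Fin; toℕ)
open import Data.Vec using (Vec; []; _∷_)
open import Data.List using (List; map; foldr; upTo)
open import Data.Bool using (if_then_else_)

-- The field F_3, with elements 0,1,2 (ordered as in ℕ) and arithmetic mod 3.
F₃ : Set
F₃ = Fin 3

infixl 6 _+₃_ _-₃_
infixl 7 _*₃_

_+₃_ : F₃ → F₃ → F₃
a +₃ b = (toℕ a +ℕ toℕ b) mod 3

_*₃_ : F₃ → F₃ → F₃
a *₃ b = (toℕ a *ℕ toℕ b) mod 3

_-₃_ : F₃ → F₃ → F₃
a -₃ b = (toℕ a +ℕ 2 *ℕ toℕ b) mod 3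

0₃ 1₃ : F₃
0₃ = 0 mod 3
1₃ = 1 mod 3

max₂ : F₃ → F₃ → F₃
max₂ a b = if toℕ a ≤ᵇ toℕ b then b else a

-- max(x) of a vector (only used for n ≥ 1; the empty case returns 0)
maxV : ∀ {n} → Vec F₃ n → F₃
maxV [] = 0₃
maxV (a ∷ []) = a
maxV (a ∷ b ∷ xs) = max₂ a (maxV (b ∷ xs))

e : ℕ → ∀ {n} → Vec F₃ n → F₃
e zero    _        = 1₃
e (suc k) []       = 0₃
e (suc k) (a ∷ xs) = e (suc k) xs +₃ a *₃ e k xs

Σ₃upto : ℕ → (ℕ → F₃) → F₃
Σ₃upto m f = foldr _+₃_ 0₃ (map f (upTo (suc m)))

-- Let E and O be the sums of the even and of the odd elementary symmetric
-- polynomials, so that ∑ᵢ eᵢ = E + O.  Prepending a variable a acts linearly: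
-- (E, O) ↦ (E + aO, O + aE).  The value of max(x) pins (E, O) down:
-- max 0 gives (1, 0), max 1 gives E = O = ±1, and max 2 gives E + O = 0.
-- This invariant is preserved by the step, and in each of the three cases
-- E (E + O) − 1 = max(x).  Both finite facts are checked over all of F₃.
module Submission where

open import Defs
open import Data.Nat using (ℕ; zero; suc; _≤_; _<_; _/_; _*_; _+_; _%_; s≤s)
open import Data.Nat.Properties using (≤-pred; <⇒≤; m<n⇒m<1+n; n<1+n; *-suc; *-comm; +-monoˡ-<; module ≤-Reasoning)
open import Data.Nat.DivMod using (m≡m%n+[m/n]*n; m%n<n)
open import Data.Fin using (zero; suc; _≟_)
open import Data.Fin.Properties using (all?)
open import Data.Vec using (Vec; []; _∷_)
open import Data.List using (map; foldr; applyUpTo)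
open import Data.Product using (_×_; _,_)
open import Function using (_∘_)
open import Relation.Nullary.Decidable using (Dec; from-yes; _×-dec_; _→-dec_)
open import Relation.Binary.PropositionalEquality

+₃-assoc : ∀ a b c → a +₃ b +₃ c ≡ a +₃ (b +₃ c)
+₃-assoc = from-yes (all? λ a → all? λ b → all? λ c → a +₃ b +₃ c ≟ a +₃ (b +₃ c))

+₃-interchange : ∀ a b c d → (a +₃ b) +₃ (c +₃ d) ≡ (a +₃ c) +₃ (b +₃ d)
+₃-interchange = from-yes (all? λ a → all? λ b → all? λ c → all? λ d →
  (a +₃ b) +₃ (c +₃ d) ≟ (a +₃ c) +₃ (b +₃ d))

*₃-distribˡ-+₃ : ∀ a b c → a *₃ (b +₃ c) ≡ a *₃ b +₃ a *₃ c
*₃-distribˡ-+₃ = from-yes (all? λ a → all? λ b → all? λ c → a *₃ (b +₃ c) ≟ a *₃ b +₃ a *₃ c)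

*₃-zeroʳ : ∀ a → a *₃ 0₃ ≡ 0₃
*₃-zeroʳ = from-yes (all? λ a → a *₃ 0₃ ≟ 0₃)

max₂-identityʳ : ∀ a → max₂ a 0₃ ≡ a
max₂-identityʳ = from-yes (all? λ a → max₂ a 0₃ ≟ a)

maxV-∷ : ∀ a {n} (xs : Vec F₃ n) → maxV (a ∷ xs) ≡ max₂ a (maxV xs)
maxV-∷ a []       = sym (max₂-identityʳ a)
maxV-∷ a (_ ∷ _) = refl

Σ< : ℕ → (ℕ → F₃) → F₃
Σ< zero    f = 0₃
Σ< (suc k) f = f 0 +₃ Σ< k (f ∘ suc)

foldr-map-applyUpTo : ∀ k (f : ℕ → F₃) g → foldr _+₃_ 0₃ (map f (applyUpTo g k)) ≡ Σ< k (f ∘ g)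
foldr-map-applyUpTo zero    f g = refl
foldr-map-applyUpTo (suc k) f g = cong (f (g 0) +₃_) (foldr-map-applyUpTo k f (g ∘ suc))

Σ₃upto≡Σ< : ∀ m f → Σ₃upto m f ≡ Σ< (suc m) f
Σ₃upto≡Σ< m f = foldr-map-applyUpTo (suc m) f (λ i → i)

Σ<-cong : ∀ k {f g : ℕ → F₃} → (∀ i → f i ≡ g i) → Σ< k f ≡ Σ< k g
Σ<-cong zero    f≗g = refl
Σ<-cong (suc k) f≗g = cong₂ _+₃_ (f≗g 0) (Σ<-cong k (f≗g ∘ suc))

Σ<-zero : ∀ k → Σ< k (λ _ → 0₃) ≡ 0₃
Σ<-zero zero    = refl
Σ<-zero (suc k) = cong (0₃ +₃_) (Σ<-zero k)

Σ<-+ : ∀ k f g → Σ< k (λ i → f i +₃ g i) ≡ Σ< k f +₃ Σ< k g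
Σ<-+ zero    f g = refl
Σ<-+ (suc k) f g = trans (cong (f 0 +₃ g 0 +₃_) (Σ<-+ k (f ∘ suc) (g ∘ suc)))
                         (+₃-interchange (f 0) (g 0) (Σ< k (f ∘ suc)) (Σ< k (g ∘ suc)))

Σ<-* : ∀ k a f → Σ< k (λ i → a *₃ f i) ≡ a *₃ Σ< k f
Σ<-* zero    a f = sym (*₃-zeroʳ a)
Σ<-* (suc k) a f = trans (cong (a *₃ f 0 +₃_) (Σ<-* k a (f ∘ suc)))
                         (sym (*₃-distribˡ-+₃ a (f 0) (Σ< k (f ∘ suc))))

Σ<-e-∷ : ∀ k (g : ℕ → ℕ) a {n} (xs : Vec F₃ n) →
  Σ< k (λ i → e (suc (g i)) (a ∷ xs)) ≡ Σ< k (λ i → e (suc (g i)) xs) +₃ a *₃ Σ< k (λ i → e (g i) xs)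
Σ<-e-∷ k g a xs = trans (Σ<-+ k (λ i → e (suc (g i)) xs) (λ i → a *₃ e (g i) xs))
                        (cong (Σ< k (λ i → e (suc (g i)) xs) +₃_) (Σ<-* k a (λ i → e (g i) xs)))

Σ<-e-even-suc : ∀ k {n} (x : Vec F₃ n) → Σ< (suc k) (λ i → e (2 * i) x) ≡ 1₃ +₃ Σ< k (λ i → e (2 + 2 * i) x)
Σ<-e-even-suc k x = cong (1₃ +₃_) (Σ<-cong k (λ i → cong (λ j → e j x) (*-suc 2 i)))

evenSym oddSym : ∀ {n} → Vec F₃ n → F₃
evenSym []       = 1₃
evenSym (a ∷ xs) = evenSym xs +₃ a *₃ oddSym xs
oddSym  []       = 0₃
oddSym  (a ∷ xs) = oddSym xs +₃ a *₃ evenSym xs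

Σ<-e-even≡evenSym : ∀ {n} (x : Vec F₃ n) k → n < 2 * k → Σ< k (λ i → e (2 * i) x) ≡ evenSym x
Σ<-e-odd≡oddSym   : ∀ {n} (x : Vec F₃ n) k → n ≤ 2 * k → Σ< k (λ i → e (suc (2 * i)) x) ≡ oddSym x

Σ<-e-even≡evenSym []       (suc k) _ = cong (1₃ +₃_) (Σ<-zero k)
Σ<-e-even≡evenSym {suc n} (a ∷ xs) (suc k) n<2k = begin
    Σ< (suc k) (λ i → e (2 * i) (a ∷ xs))
  ≡⟨ Σ<-e-even-suc k (a ∷ xs) ⟩
    1₃ +₃ Σ< k (λ i → e (2 + 2 * i) (a ∷ xs))
  ≡⟨ cong (1₃ +₃_) (Σ<-e-∷ k (λ i → suc (2 * i)) a xs) ⟩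
    1₃ +₃ (Σ< k (λ i → e (2 + 2 * i) xs) +₃ a *₃ Σ< k (λ i → e (suc (2 * i)) xs))
  ≡⟨ sym (+₃-assoc 1₃ (Σ< k (λ i → e (2 + 2 * i) xs)) (a *₃ Σ< k (λ i → e (suc (2 * i)) xs))) ⟩
    (1₃ +₃ Σ< k (λ i → e (2 + 2 * i) xs)) +₃ a *₃ Σ< k (λ i → e (suc (2 * i)) xs)
  ≡⟨ cong (_+₃ a *₃ Σ< k (λ i → e (suc (2 * i)) xs)) (sym (Σ<-e-even-suc k xs)) ⟩
    Σ< (suc k) (λ i → e (2 * i) xs) +₃ a *₃ Σ< k (λ i → e (suc (2 * i)) xs)
  ≡⟨ cong₂ (λ s t → s +₃ a *₃ t) (Σ<-e-even≡evenSym xs (suc k) (<⇒≤ n<2k))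
                                 (Σ<-e-odd≡oddSym xs k n≤2k) ⟩
    evenSym xs +₃ a *₃ oddSym xs ∎
  where
  open ≡-Reasoning
  n≤2k : n ≤ 2 * k
  n≤2k = ≤-pred (≤-pred (subst (suc n <_) (*-suc 2 k) n<2k))
Σ<-e-odd≡oddSym []       k _ = Σ<-zero k
Σ<-e-odd≡oddSym (a ∷ xs) k n<2k =
  trans (Σ<-e-∷ k (2 *_) a xs)
        (cong₂ (λ s t → s +₃ a *₃ t) (Σ<-e-odd≡oddSym xs k (<⇒≤ n<2k)) (Σ<-e-even≡evenSym xs k n<2k))

Σ<-e≡evenSym+oddSym : ∀ {n} (x : Vec F₃ n) k → n < k → Σ< k (λ i → e i x) ≡ evenSym x +₃ oddSym x
Σ<-e≡evenSym+oddSym []       (suc k) _ = cong (1₃ +₃_) (Σ<-zero k)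
Σ<-e≡evenSym+oddSym (a ∷ xs) (suc k) (s≤s n<k) = begin
    1₃ +₃ Σ< k (λ i → e (suc i) (a ∷ xs))
  ≡⟨ cong (1₃ +₃_) (Σ<-e-∷ k (λ i → i) a xs) ⟩
    1₃ +₃ (Σ< k (λ i → e (suc i) xs) +₃ a *₃ Σ< k (λ i → e i xs))
  ≡⟨ sym (+₃-assoc 1₃ (Σ< k (λ i → e (suc i) xs)) (a *₃ Σ< k (λ i → e i xs))) ⟩
    Σ< (suc k) (λ i → e i xs) +₃ a *₃ Σ< k (λ i → e i xs)
  ≡⟨ cong₂ (λ s t → s +₃ a *₃ t) (Σ<-e≡evenSym+oddSym xs (suc k) (m<n⇒m<1+n n<k))
                                 (Σ<-e≡evenSym+oddSym xs k n<k) ⟩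
    (evenSym xs +₃ oddSym xs) +₃ a *₃ (evenSym xs +₃ oddSym xs)
  ≡⟨ regroup a (evenSym xs) (oddSym xs) ⟩
    (evenSym xs +₃ a *₃ oddSym xs) +₃ (oddSym xs +₃ a *₃ evenSym xs) ∎
  where
  open ≡-Reasoning
  regroup : ∀ a E O → (E +₃ O) +₃ a *₃ (E +₃ O) ≡ (E +₃ a *₃ O) +₃ (O +₃ a *₃ E)
  regroup = from-yes (all? λ a → all? λ E → all? λ O →
    (E +₃ O) +₃ a *₃ (E +₃ O) ≟ (E +₃ a *₃ O) +₃ (O +₃ a *₃ E))

MaxInvariant : F₃ → F₃ → F₃ → Set
MaxInvariant zero             E O = E ≡ 1₃ × O ≡ 0₃
MaxInvariant (suc zero)       E O = E ≡ O × E *₃ E ≡ 1₃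
MaxInvariant (suc (suc zero)) E O = E +₃ O ≡ 0₃

maxInvariant? : ∀ m E O → Dec (MaxInvariant m E O)
maxInvariant? zero             E O = E ≟ 1₃ ×-dec O ≟ 0₃
maxInvariant? (suc zero)       E O = E ≟ O ×-dec E *₃ E ≟ 1₃
maxInvariant? (suc (suc zero)) E O = E +₃ O ≟ 0₃

maxInvariant-∷ : ∀ a m E O → MaxInvariant m E O →
  MaxInvariant (max₂ a m) (E +₃ a *₃ O) (O +₃ a *₃ E)
maxInvariant-∷ = from-yes (all? λ a → all? λ m → all? λ E → all? λ O →
  maxInvariant? m E O →-dec maxInvariant? (max₂ a m) (E +₃ a *₃ O) (O +₃ a *₃ E))

maxInvariant⇒formula : ∀ m E O → MaxInvariant m E O → m ≡ E *₃ (E +₃ O) -₃ 1₃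
maxInvariant⇒formula = from-yes (all? λ m → all? λ E → all? λ O →
  maxInvariant? m E O →-dec m ≟ E *₃ (E +₃ O) -₃ 1₃)

maxInvariant : ∀ {n} (x : Vec F₃ n) → MaxInvariant (maxV x) (evenSym x) (oddSym x)
maxInvariant []       = refl , refl
maxInvariant (a ∷ xs) = subst (λ m → MaxInvariant m (evenSym (a ∷ xs)) (oddSym (a ∷ xs))) (sym (maxV-∷ a xs))
  (maxInvariant-∷ a (maxV xs) (evenSym xs) (oddSym xs) (maxInvariant xs))

maxV≡evenSym*[evenSym+oddSym]-1 : ∀ {n} (x : Vec F₃ n) →
  maxV x ≡ evenSym x *₃ (evenSym x +₃ oddSym x) -₃ 1₃
maxV≡evenSym*[evenSym+oddSym]-1 x = maxInvariant⇒formula (maxV x) (evenSym x) (oddSym x) (maxInvariant x)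

n<2*[1+n/2] : ∀ n → n < 2 * suc (n / 2)
n<2*[1+n/2] n = begin-strict
  n                 ≡⟨ m≡m%n+[m/n]*n n 2 ⟩
  n % 2 + n / 2 * 2 <⟨ +-monoˡ-< (n / 2 * 2) (m%n<n n 2) ⟩
  2 + n / 2 * 2     ≡⟨ cong (2 +_) (*-comm (n / 2) 2) ⟩
  2 + 2 * (n / 2)   ≡⟨ sym (*-suc 2 (n / 2)) ⟩
  2 * suc (n / 2)   ∎
  where open ≤-Reasoning

proposition3p3 : (n : ℕ) → 1 ≤ n → (x : Vec F₃ n) →
    maxV x ≡ (Σ₃upto (n / 2) (λ i → e (2 * i) x)) *₃ (Σ₃upto n (λ i → e i x)) -₃ 1₃
proposition3p3 n _ x =
  trans (maxV≡evenSym*[evenSym+oddSym]-1 x) (sym (cong₂ (λ s t → s *₃ t -₃ 1₃) evens all))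
  where
  evens : Σ₃upto (n / 2) (λ i → e (2 * i) x) ≡ evenSym x
  evens = trans (Σ₃upto≡Σ< (n / 2) (λ i → e (2 * i) x)) (Σ<-e-even≡evenSym x (suc (n / 2)) (n<2*[1+n/2] n))
  all : Σ₃upto n (λ i → e i x) ≡ evenSym x +₃ oddSym x
  all = trans (Σ₃upto≡Σ< n (λ i → e i x)) (Σ<-e≡evenSym+oddSym x (suc n) (n<1+n n))
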